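{- Let $N$ be a positive integer and $[N]=\{1,\ldots,N\}$. Let $\{\log_3 N\}=\log_3 N-\lfloor\log_3 N\rfloor$. The following are equivalent: (i) $\{\log_3 N\}<1-\log_3 2$; (ii) the set $S_1=\{1,3,3^2,\ldots,3^{\lfloor\log_3 N\rfloor}\}$ is a subset of $[N]$ which is a minimum 1-spanning subset of $[N]$ (i.e. $\langle S_1\rangle\supset[N]$ and $|S_1|=d_s([N])$) and is a maximal dissociated subset of $[N]$. In particular, when these hold, $d_s([N])=d_d^-([N])=\lfloor\log_3 N\rfloor+1$.
   Context: $[N]$ is viewed as an additive set in $\mathbb{Z}$. The 1-span $\langle S\rangle$ is the set of all sums $\sum_{s\in S}\varepsilon_s s$ with $\varepsilon_s\in\{ -1,0,1\}$; $d_s(A)=\min\{|S|:S\subset A,\ \langle S\rangle\supset A\}$. A set is dissociated if its subset sums are pairwise distinct; $D\subset A$ is maximal dissociated in $A$ if no dissociated $D'\subset A$ strictly contains $D$; $d_d^-(A)=\min\{|D|:D\subset A\text{ maximal dissociated}\}$. -}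

module Defs where

open import Data.Nat using (ℕ; zero; suc; _+_; _*_; _^_; _≤_; _<_)
open import Data.Integer as ℤ using (ℤ; +_)
open import Data.Bool using (Bool; true; false)
open import Data.List using (List; []; _∷_; length; map; upTo)
open import Data.List.Relation.Unary.All using (All)
open import Data.List.Relation.Unary.Unique.Propositional using (Unique)
open import Data.List.Membership.Propositional using (_∈_; _∉_)
open import Data.Vec using (Vec; []; _∷_)
open import Data.Product using (Σ; ∃; _×_; _,_)
open import Relation.Binary.PropositionalEquality using (_≡_)
open import Relation.Nullary using (¬_)

-- A finite set of positive integers is represented by a duplicate-free list.
-- "S is a subset of [N] = {1,…,N}"
InRange : ℕ → ℕ → Set
InRange N x = (1 ≤ x) × (x ≤ N)

SubsetOf : ℕ → List ℕ → Set
SubsetOf N S = Unique S × All (InRange N) S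

data Sign : Set where
  minus zer plus : Sign

signedSum : (S : List ℕ) → Vec Sign (length S) → ℤ
signedSum []      []            = + 0
signedSum (s ∷ S) (minus ∷ ε)   = ℤ.- (+ s) ℤ.+ signedSum S ε
signedSum (s ∷ S) (zer ∷ ε)     = signedSum S ε
signedSum (s ∷ S) (plus ∷ ε)    = + s ℤ.+ signedSum S ε

InSpan : List ℕ → ℤ → Set
InSpan S x = Σ (Vec Sign (length S)) λ ε → signedSum S ε ≡ x

Spans : ℕ → List ℕ → Set
Spans N S = ∀ x → InRange N x → InSpan S (+ x)

subsetSum : (S : List ℕ) → Vec Bool (length S) → ℕ
subsetSum []      []           = 0
subsetSum (s ∷ S) (true ∷ b)   = s + subsetSum S b
subsetSum (s ∷ S) (false ∷ b)  = subsetSum S b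

-- subset sums pairwise distinct (S duplicate-free, so distinct Bool vectors = distinct subsets)
Dissociated : List ℕ → Set
Dissociated S = ∀ a b → subsetSum S a ≡ subsetSum S b → a ≡ b

_⊆_ : List ℕ → List ℕ → Set
A ⊆ B = ∀ {x} → x ∈ A → x ∈ B

_⊂_ : List ℕ → List ℕ → Set
A ⊂ B = A ⊆ B × ∃ λ x → x ∈ B × x ∉ A

MaxDissociated : ℕ → List ℕ → Set
MaxDissociated N D =
  SubsetOf N D × Dissociated D ×
  (∀ D' → SubsetOf N D' → Dissociated D' → ¬ (D ⊂ D'))

IsDs : ℕ → ℕ → Set
IsDs N m =
  (∃ λ S → SubsetOf N S × Spans N S × length S ≡ m) ×
  (∀ S → SubsetOf N S → Spans N S → m ≤ length S)

IsDdMinus : ℕ → ℕ → Set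
IsDdMinus N m =
  (∃ λ D → MaxDissociated N D × length D ≡ m) ×
  (∀ D → MaxDissociated N D → m ≤ length D)

MinSpanning : ℕ → List ℕ → Set
MinSpanning N S = SubsetOf N S × Spans N S × IsDs N (length S)

IsFloorLog3 : ℕ → ℕ → Set
IsFloorLog3 N k = (3 ^ k ≤ N) × (N < 3 ^ suc k)

powersOf3 : ℕ → List ℕ
powersOf3 k = map (3 ^_) (upTo (suc k))

-- condition (i): {log₃ N} < 1 - log₃ 2, i.e. N < 3^(k+1)/2
FracCond : ℕ → ℕ → Set
FracCond N k = 2 * N < 3 ^ suc k

-- The 1-span of S has at most 3^|S| elements and contains 0, 1, …, N when S spans [N]; hence
-- every spanning set of [N] has more than ⌊log₃ N⌋ elements. A maximal dissociated set spans,
-- since an element outside its span could be added to it. The powers 1, 3, …, 3^k are dissociated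
-- (base-3 digits are unique) and, by balanced ternary, span exactly the integers of absolute value
-- at most 1 + 3 + ⋯ + 3^k = (3^(k+1) − 1)/2; this contains [N] iff 2N < 3^(k+1). A dissociated
-- spanning set is maximal dissociated, so in that case S₁ attains the lower bound k + 1 for both
-- d_s([N]) and d_d^-([N]).
module Submission where

open import Defs hiding (_⊆_)
open import Data.Nat using (ℕ; zero; suc; _+_; _*_; _^_; _≤_; _<_; z≤n; s≤s; >-nonZero)
open import Data.Nat.Properties
open import Data.Nat.Divisibility using (_∣_; ∣-refl; ∣-trans; _∣0; ∣m∣n⇒∣m+n; ∣m+n∣m⇒∣n; n∣m*n; ∣⇒≤)
open import Data.Nat.ListAction using (sum)
open import Data.Integer as ℤ using (ℤ; -_) renaming (+_ to pos; _+_ to _+ℤ_)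
import Data.Integer.Properties as ℤᵖ
open import Data.Integer.Tactic.RingSolver using (solve-∀)
open import Data.Nat.Tactic.RingSolver using () renaming (solve-∀ to ℕ-solve-∀)
open import Algebra.Properties.AbelianGroup ℤᵖ.+-0-abelianGroup using (∙-cancelʳ)
open import Algebra.Properties.CommutativeSemigroup +-commutativeSemigroup using (x∙yz≈y∙xz)
open import Data.Bool using (Bool; true; false)
open import Data.List using (List; []; _∷_; [_]; _++_; length; map; upTo; applyUpTo)
open import Data.List.Properties using (length-map; length-++; length-upTo; map-upTo)
open import Data.List.Relation.Unary.All as All using (All; []; _∷_)
open import Data.List.Relation.Unary.All.Properties using (¬Any⇒All¬)
open import Data.List.Relation.Unary.Any as Any using (here; there; any?)
open import Data.List.Relation.Unary.Unique.Propositional using (Unique; []; _∷_)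
import Data.List.Relation.Unary.Unique.Propositional.Properties as Unique
open import Data.List.Relation.Binary.Subset.Propositional using (_⊆_)
open import Data.List.Membership.Propositional using (_∈_; _∉_)
open import Data.List.Membership.Propositional.Properties using (∈-∃++; ∈-map⁺; ∈-map⁻; ∈-upTo⁻)
open import Data.List.Relation.Binary.Permutation.Propositional as ↭ using (_↭_; ↭-sym)
open import Data.List.Relation.Binary.Permutation.Propositional.Properties using (∈-resp-↭; ↭-length; shift)
open import Data.Vec using (Vec; []; _∷_; replicate)
open import Data.Vec.Properties using (∷-injective)
open import Data.Product using (∃; _×_; _,_; proj₁)
open import Function using (_∘_)
open import Function.Bundles using (_⇔_; mk⇔)
open import Function.Definitions using (Injective)
open import Relation.Binary.PropositionalEquality hiding ([_])
open import Relation.Nullary using (¬_; Dec; yes; no; contradiction)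
open import Relation.Binary.Definitions using (tri<; tri≈; tri>)
open import Relation.Nullary.Decidable using (map′)

module _ {A : Set} where

  ∈⇒↭∷ : ∀ {x : A} {xs} → x ∈ xs → ∃ λ ys → xs ↭ x ∷ ys
  ∈⇒↭∷ {x} x∈xs with ys , zs , refl ← ∈-∃++ x∈xs = ys ++ zs , shift x ys zs

  ⊆-↭∷⁻ : ∀ {x : A} {xs ys ys′} → All (x ≢_) xs → x ∷ xs ⊆ ys → ys ↭ x ∷ ys′ → xs ⊆ ys′
  ⊆-↭∷⁻ x∉xs x∷xs⊆ys ys↭x∷ys′ y∈xs with ∈-resp-↭ ys↭x∷ys′ (x∷xs⊆ys (there y∈xs))
  ... | here y≡x    = contradiction (sym y≡x) (All.lookup x∉xs y∈xs)
  ... | there y∈ys′ = y∈ys′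

  unique-⊆⇒↭++ : ∀ {xs ys : List A} → Unique xs → xs ⊆ ys → ∃ λ zs → ys ↭ xs ++ zs
  unique-⊆⇒↭++ {[]} {ys} [] _ = ys , ↭.refl
  unique-⊆⇒↭++ {x ∷ xs} (x∉xs ∷ uxs) x∷xs⊆ys
    with ys′ , ys↭x∷ys′ ← ∈⇒↭∷ (x∷xs⊆ys (here refl))
    with zs , ys′↭xs++zs ← unique-⊆⇒↭++ uxs (⊆-↭∷⁻ x∉xs x∷xs⊆ys ys↭x∷ys′)
    = zs , ↭.trans ys↭x∷ys′ (↭.prep x ys′↭xs++zs)

  unique-⊆⇒length≤ : ∀ {xs ys : List A} → Unique xs → xs ⊆ ys → length xs ≤ length ys
  unique-⊆⇒length≤ {xs} uxs xs⊆ys with zs , ys↭xs++zs ← unique-⊆⇒↭++ uxs xs⊆ys =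
    subst (length xs ≤_) (sym (trans (↭-length ys↭xs++zs) (length-++ xs))) (m≤m+n _ _)

dissociated-pullback : ∀ {xs ys} (f : Vec Bool (length xs) → Vec Bool (length ys)) →
  Injective _≡_ _≡_ f → (∀ b → subsetSum ys (f b) ≡ subsetSum xs b) →
  Dissociated ys → Dissociated xs
dissociated-pullback f f-injective f-sum dys a b Σa≡Σb =
  f-injective (dys (f a) (f b) (trans (f-sum a) (trans Σa≡Σb (sym (f-sum b)))))

↭-subset : ∀ {xs ys : List ℕ} → xs ↭ ys → Vec Bool (length xs) → Vec Bool (length ys)
↭-subset ↭.refl            b           = b
↭-subset (↭.prep x p)      (a ∷ b)     = a ∷ ↭-subset p b
↭-subset (↭.swap x y p)    (a ∷ a′ ∷ b) = a′ ∷ a ∷ ↭-subset p b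
↭-subset (↭.trans p q)     b           = ↭-subset q (↭-subset p b)

↭-subset-injective : ∀ {xs ys : List ℕ} (p : xs ↭ ys) → Injective _≡_ _≡_ (↭-subset p)
↭-subset-injective ↭.refl eq = eq
↭-subset-injective (↭.prep x p) {a ∷ b} {a′ ∷ b′} eq
  with refl , eq′ ← ∷-injective eq = cong (a ∷_) (↭-subset-injective p eq′)
↭-subset-injective (↭.swap x y p) {a ∷ c ∷ b} {a′ ∷ c′ ∷ b′} eq
  with refl , eq′ ← ∷-injective eq
  with refl , eq″ ← ∷-injective eq′ = cong (λ v → a ∷ c ∷ v) (↭-subset-injective p eq″)
↭-subset-injective (↭.trans p q) eq = ↭-subset-injective p (↭-subset-injective q eq)

subsetSum-↭-subset : ∀ {xs ys} (p : xs ↭ ys) b → subsetSum ys (↭-subset p b) ≡ subsetSum xs b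
subsetSum-↭-subset ↭.refl b = refl
subsetSum-↭-subset (↭.prep x p) (true ∷ b)  = cong (x +_) (subsetSum-↭-subset p b)
subsetSum-↭-subset (↭.prep x p) (false ∷ b) = subsetSum-↭-subset p b
subsetSum-↭-subset (↭.swap x y p) (true ∷ true ∷ b) =
  trans (cong (λ s → y + (x + s)) (subsetSum-↭-subset p b)) (x∙yz≈y∙xz y x _)
subsetSum-↭-subset (↭.swap x y p) (true ∷ false ∷ b)  = cong (x +_) (subsetSum-↭-subset p b)
subsetSum-↭-subset (↭.swap x y p) (false ∷ true ∷ b)  = cong (y +_) (subsetSum-↭-subset p b)
subsetSum-↭-subset (↭.swap x y p) (false ∷ false ∷ b) = subsetSum-↭-subset p b
subsetSum-↭-subset (↭.trans p q) b = trans (subsetSum-↭-subset q _) (subsetSum-↭-subset p b)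

padSubset : ∀ (xs ys : List ℕ) → Vec Bool (length xs) → Vec Bool (length (xs ++ ys))
padSubset []       ys []      = replicate (length ys) false
padSubset (x ∷ xs) ys (a ∷ b) = a ∷ padSubset xs ys b

padSubset-injective : ∀ (xs ys : List ℕ) → Injective _≡_ _≡_ (padSubset xs ys)
padSubset-injective []       ys {[]}    {[]}     eq = refl
padSubset-injective (x ∷ xs) ys {a ∷ b} {a′ ∷ b′} eq
  with refl , eq′ ← ∷-injective eq = cong (a ∷_) (padSubset-injective xs ys eq′)

subsetSum-padSubset : ∀ xs ys b → subsetSum (xs ++ ys) (padSubset xs ys b) ≡ subsetSum xs b
subsetSum-padSubset []       ys          [] = subsetSum-empty ys
  where
  subsetSum-empty : ∀ zs → subsetSum zs (replicate (length zs) false) ≡ 0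
  subsetSum-empty []       = refl
  subsetSum-empty (z ∷ zs) = subsetSum-empty zs
subsetSum-padSubset (x ∷ xs) ys (true ∷ b)  = cong (x +_) (subsetSum-padSubset xs ys b)
subsetSum-padSubset (x ∷ xs) ys (false ∷ b) = subsetSum-padSubset xs ys b

dissociated-⊆ : ∀ {xs ys} → Unique xs → xs ⊆ ys → Dissociated ys → Dissociated xs
dissociated-⊆ {xs} {ys} uxs xs⊆ys dys with zs , ys↭xs++zs ← unique-⊆⇒↭++ uxs xs⊆ys =
  dissociated-pullback {xs} {xs ++ zs} (padSubset xs zs) (padSubset-injective xs zs) (subsetSum-padSubset xs zs)
    (dissociated-pullback {xs ++ zs} {ys} (↭-subset xs++zs↭ys) (↭-subset-injective xs++zs↭ys)
      (subsetSum-↭-subset xs++zs↭ys) dys)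
  where
  xs++zs↭ys : xs ++ zs ↭ ys
  xs++zs↭ys = ↭-sym ys↭xs++zs

_⊖_ : ∀ {n} → Vec Bool n → Vec Bool n → Vec Sign n
[]          ⊖ []          = []
(true ∷ p)  ⊖ (true ∷ q)  = zer ∷ p ⊖ q
(true ∷ p)  ⊖ (false ∷ q) = plus ∷ p ⊖ q
(false ∷ p) ⊖ (true ∷ q)  = minus ∷ p ⊖ q
(false ∷ p) ⊖ (false ∷ q) = zer ∷ p ⊖ q

positivePart negativePart : ∀ {n} → Vec Sign n → Vec Bool n
positivePart []          = []
positivePart (minus ∷ ε) = false ∷ positivePart ε
positivePart (zer ∷ ε)   = false ∷ positivePart ε
positivePart (plus ∷ ε)  = true ∷ positivePart ε
negativePart []          = []
negativePart (minus ∷ ε) = true ∷ negativePart ε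
negativePart (zer ∷ ε)   = false ∷ negativePart ε
negativePart (plus ∷ ε)  = false ∷ negativePart ε

positivePart⊖negativePart : ∀ {n} (ε : Vec Sign n) → positivePart ε ⊖ negativePart ε ≡ ε
positivePart⊖negativePart []          = refl
positivePart⊖negativePart (minus ∷ ε) = cong (minus ∷_) (positivePart⊖negativePart ε)
positivePart⊖negativePart (zer ∷ ε)   = cong (zer ∷_) (positivePart⊖negativePart ε)
positivePart⊖negativePart (plus ∷ ε)  = cong (plus ∷_) (positivePart⊖negativePart ε)

signedSum-⊖ : ∀ S p q → signedSum S (p ⊖ q) +ℤ pos (subsetSum S q) ≡ pos (subsetSum S p)
signedSum-⊖ []      []          []          = refl
signedSum-⊖ (s ∷ S) (true ∷ p)  (true ∷ q)  =
  trans (shuffle (pos s) (signedSum S (p ⊖ q)) _) (cong (pos s +ℤ_) (signedSum-⊖ S p q))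
  where shuffle : ∀ a σ b → σ +ℤ (a +ℤ b) ≡ a +ℤ (σ +ℤ b)
        shuffle = solve-∀
signedSum-⊖ (s ∷ S) (true ∷ p)  (false ∷ q) =
  trans (ℤᵖ.+-assoc (pos s) (signedSum S (p ⊖ q)) _) (cong (pos s +ℤ_) (signedSum-⊖ S p q))
signedSum-⊖ (s ∷ S) (false ∷ p) (true ∷ q)  =
  trans (cancel (pos s) (signedSum S (p ⊖ q)) _) (signedSum-⊖ S p q)
  where cancel : ∀ a σ b → (- a +ℤ σ) +ℤ (a +ℤ b) ≡ σ +ℤ b
        cancel = solve-∀
signedSum-⊖ (s ∷ S) (false ∷ p) (false ∷ q) = signedSum-⊖ S p q

signedSum≤sum : ∀ S ε → signedSum S ε ℤ.≤ pos (sum S)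
signedSum≤sum []      []          = ℤᵖ.≤-refl
signedSum≤sum (s ∷ S) (minus ∷ ε) = ℤᵖ.+-mono-≤ (ℤᵖ.neg-≤-pos {s} {s}) (signedSum≤sum S ε)
signedSum≤sum (s ∷ S) (zer ∷ ε)   = ℤᵖ.≤-trans (signedSum≤sum S ε) (ℤ.+≤+ (m≤n+m (sum S) s))
signedSum≤sum (s ∷ S) (plus ∷ ε)  = ℤᵖ.+-mono-≤ (ℤᵖ.≤-refl {pos s}) (signedSum≤sum S ε)

inSpan⇒≤sum : ∀ {S x} → InSpan S (pos x) → x ≤ sum S
inSpan⇒≤sum {S} (ε , Σε≡x) = ℤᵖ.drop‿+≤+ (subst (ℤ._≤ pos (sum S)) Σε≡x (signedSum≤sum S ε))

signedSum-zeros : ∀ S → signedSum S (replicate (length S) zer) ≡ pos 0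
signedSum-zeros []      = refl
signedSum-zeros (_ ∷ S) = signedSum-zeros S

∈⇒inSpan : ∀ {x S} → x ∈ S → InSpan S (pos x)
∈⇒inSpan {S = s ∷ S} (here refl) =
  plus ∷ replicate _ zer , trans (cong (pos s +ℤ_) (signedSum-zeros S)) (cong pos (+-identityʳ s))
∈⇒inSpan {S = s ∷ S} (there x∈S) with ε , Σε≡x ← ∈⇒inSpan x∈S = zer ∷ ε , Σε≡x

-- If x = Σp − Σq then {x} ∪ q and p are distinct subsets of x ∷ S with equal sums.
inSpan⇒¬dissociated-∷ : ∀ {x} S → InSpan S (pos x) → ¬ Dissociated (x ∷ S)
inSpan⇒¬dissociated-∷ {x} S (ε , Σε≡x) dis =
  contradiction (proj₁ (∷-injective (dis (true ∷ q) (false ∷ p) sums≡))) λ ()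
  where
  p = positivePart ε
  q = negativePart ε
  sums≡ : x + subsetSum S q ≡ subsetSum S p
  sums≡ = ℤᵖ.+-injective (begin
    pos x +ℤ pos (subsetSum S q)                ≡⟨ cong (_+ℤ pos (subsetSum S q)) (sym Σε≡x) ⟩
    signedSum S ε +ℤ pos (subsetSum S q)        ≡⟨ cong (λ e → signedSum S e +ℤ pos (subsetSum S q))
                                                         (sym (positivePart⊖negativePart ε)) ⟩
    signedSum S (p ⊖ q) +ℤ pos (subsetSum S q)  ≡⟨ signedSum-⊖ S p q ⟩
    pos (subsetSum S p)                          ∎)
    where open ≡-Reasoning

subsetSum-difference⇒inSpan : ∀ {x} S a b → x + subsetSum S b ≡ subsetSum S a → InSpan S (pos x)
subsetSum-difference⇒inSpan S a b eq = a ⊖ b , ∙-cancelʳ _ _ _ (trans (signedSum-⊖ S a b) (cong pos (sym eq)))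

dissociated-∷ : ∀ {x S} → Dissociated S → ¬ InSpan S (pos x) → Dissociated (x ∷ S)
dissociated-∷ {x} dis x∉⟨S⟩ (true ∷ a)  (true ∷ b)  eq = cong (true ∷_) (dis a b (+-cancelˡ-≡ x _ _ eq))
dissociated-∷     dis x∉⟨S⟩ (false ∷ a) (false ∷ b) eq = cong (false ∷_) (dis a b eq)
dissociated-∷ {S = S} dis x∉⟨S⟩ (true ∷ a) (false ∷ b) eq =
  contradiction (subsetSum-difference⇒inSpan S b a eq) x∉⟨S⟩
dissociated-∷ {S = S} dis x∉⟨S⟩ (false ∷ a) (true ∷ b) eq =
  contradiction (subsetSum-difference⇒inSpan S a b (sym eq)) x∉⟨S⟩

prependSigns : ∀ {n} → List (Vec Sign n) → List (Vec Sign (suc n))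
prependSigns []       = []
prependSigns (v ∷ vs) = (minus ∷ v) ∷ (zer ∷ v) ∷ (plus ∷ v) ∷ prependSigns vs

signVectors : ∀ n → List (Vec Sign n)
signVectors zero    = [ [] ]
signVectors (suc n) = prependSigns (signVectors n)

length-prependSigns : ∀ {n} (vs : List (Vec Sign n)) → length (prependSigns vs) ≡ 3 * length vs
length-prependSigns []       = refl
length-prependSigns (v ∷ vs) = trans (cong (3 +_) (length-prependSigns vs)) (sym (*-suc 3 (length vs)))

length-signVectors : ∀ n → length (signVectors n) ≡ 3 ^ n
length-signVectors zero    = refl
length-signVectors (suc n) =
  trans (length-prependSigns (signVectors n)) (cong (3 *_) (length-signVectors n))

∈-prependSigns : ∀ {n} s {v : Vec Sign n} {vs} → v ∈ vs → (s ∷ v) ∈ prependSigns vs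
∈-prependSigns minus (here refl) = here refl
∈-prependSigns zer   (here refl) = there (here refl)
∈-prependSigns plus  (here refl) = there (there (here refl))
∈-prependSigns s     (there v∈vs) = there (there (there (∈-prependSigns s v∈vs)))

∈-signVectors : ∀ {n} (v : Vec Sign n) → v ∈ signVectors n
∈-signVectors []      = here refl
∈-signVectors (s ∷ v) = ∈-prependSigns s (∈-signVectors v)

inSpan? : ∀ S x → Dec (InSpan S x)
inSpan? S x = map′ Any.satisfied (λ (ε , Σε≡x) → Any.map (λ { refl → Σε≡x }) (∈-signVectors ε))
  (any? (λ ε → signedSum S ε ℤ.≟ x) (signVectors (length S)))

spans⇒<3^length : ∀ {N} S → Spans N S → N < 3 ^ length S
spans⇒<3^length {N} S spans = subst₂ _≤_ length-range length-sums (unique-⊆⇒length≤ unique-range range⊆sums)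
  where
  range = map pos (upTo (suc N))
  sums  = map (signedSum S) (signVectors (length S))
  unique-range : Unique range
  unique-range = Unique.map⁺ ℤᵖ.+-injective (Unique.upTo⁺ (suc N))
  length-range : length range ≡ suc N
  length-range = trans (length-map pos (upTo (suc N))) (length-upTo (suc N))
  length-sums : length sums ≡ 3 ^ length S
  length-sums = trans (length-map (signedSum S) (signVectors (length S))) (length-signVectors (length S))
  inSpan : ∀ i → i < suc N → InSpan S (pos i)
  inSpan zero    _   = replicate _ zer , signedSum-zeros S
  inSpan (suc i) i<N = spans (suc i) (s≤s z≤n , ≤-pred i<N)
  range⊆sums : range ⊆ sums
  range⊆sums z∈range with i , i∈upTo , refl ← ∈-map⁻ pos z∈range
    with ε , Σε≡i ← inSpan i (∈-upTo⁻ i∈upTo)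
    = subst (_∈ sums) Σε≡i (∈-map⁺ (signedSum S) (∈-signVectors ε))

spans⇒<length : ∀ {N k} S → 3 ^ k ≤ N → Spans N S → k < length S
spans⇒<length S 3^k≤N spans =
  ≰⇒> λ |S|≤k → <⇒≱ (spans⇒<3^length S spans) (≤-trans (^-monoʳ-≤ 3 |S|≤k) 3^k≤N)

maxDissociated⇒spans : ∀ {N D} → MaxDissociated N D → Spans N D
maxDissociated⇒spans {D = D} ((uD , D⊆[N]) , dD , maximal) x x∈[N] with inSpan? D (pos x)
... | yes x∈⟨D⟩ = x∈⟨D⟩
... | no  x∉⟨D⟩ = contradiction ((λ {_} → there) , x , here refl , x∉D)
  (maximal (x ∷ D) (¬Any⇒All¬ D x∉D ∷ uD , x∈[N] ∷ D⊆[N]) (dissociated-∷ dD x∉⟨D⟩))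
  where
  x∉D : x ∉ D
  x∉D = x∉⟨D⟩ ∘ ∈⇒inSpan

spans∧dissociated⇒maxDissociated : ∀ {N D} → SubsetOf N D → Dissociated D → Spans N D → MaxDissociated N D
spans∧dissociated⇒maxDissociated {D = D} D⊆[N]@(uD , _) dD spans =
  D⊆[N] , dD , λ where
    D′ (_ , D′⊆[N]) dD′ (D⊆D′ , x , x∈D′ , x∉D) →
      inSpan⇒¬dissociated-∷ D (spans x (All.lookup D′⊆[N] x∈D′))
        (dissociated-⊆ (¬Any⇒All¬ D x∉D ∷ uD) (λ { (here refl) → x∈D′ ; (there y∈D) → D⊆D′ y∈D }) dD′)

scaledPowersOf3 : ℕ → ℕ → List ℕ
scaledPowersOf3 c zero    = []
scaledPowersOf3 c (suc n) = c ∷ scaledPowersOf3 (3 * c) n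

repunit₃ : ℕ → ℕ
repunit₃ zero    = 0
repunit₃ (suc n) = 1 + 3 * repunit₃ n

1+2*repunit₃≡3^ : ∀ n → suc (2 * repunit₃ n) ≡ 3 ^ n
1+2*repunit₃≡3^ zero    = refl
1+2*repunit₃≡3^ (suc n) = trans (regroup (repunit₃ n)) (cong (3 *_) (1+2*repunit₃≡3^ n))
  where regroup : ∀ r → suc (2 * (1 + 3 * r)) ≡ 3 * suc (2 * r)
        regroup = ℕ-solve-∀

3c*m≡c*[3m] : ∀ c m → 3 * c * m ≡ c * (3 * m)
3c*m≡c*[3m] c m = trans (cong (_* m) (*-comm 3 c)) (*-assoc c 3 m)

c+3c*m≡c*[1+3m] : ∀ c m → c + 3 * c * m ≡ c * (1 + 3 * m)
c+3c*m≡c*[1+3m] = ℕ-solve-∀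

c<3c : ∀ {c} → 0 < c → c < 3 * c
c<3c {c} 0<c = m<m+n c (≤-trans 0<c (m≤m+n c _))

3^-injective : Injective _≡_ _≡_ (3 ^_)
3^-injective {i} {j} 3^i≡3^j with <-cmp i j
... | tri< i<j _ _ = contradiction 3^i≡3^j (<⇒≢ (^-monoʳ-< 3 (s≤s (s≤s z≤n)) i<j))
... | tri≈ _ i≡j _ = i≡j
... | tri> _ _ j<i = contradiction (sym 3^i≡3^j) (<⇒≢ (^-monoʳ-< 3 (s≤s (s≤s z≤n)) j<i))

powersOf3≡scaledPowersOf3 : ∀ k → powersOf3 k ≡ scaledPowersOf3 1 (suc k)
powersOf3≡scaledPowersOf3 k =
  trans (map-upTo (3 ^_) (suc k)) (applyUpTo≡scaledPowersOf3 (3 ^_) 1 (suc k) (λ i → sym (*-identityˡ _)))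
  where
  applyUpTo≡scaledPowersOf3 : ∀ f c n → (∀ i → f i ≡ c * 3 ^ i) → applyUpTo f n ≡ scaledPowersOf3 c n
  applyUpTo≡scaledPowersOf3 f c zero    _  = refl
  applyUpTo≡scaledPowersOf3 f c (suc n) f≗ =
    cong₂ _∷_ (trans (f≗ 0) (*-identityʳ c))
      (applyUpTo≡scaledPowersOf3 (f ∘ suc) (3 * c) n (λ i → trans (f≗ (suc i)) (sym (3c*m≡c*[3m] c (3 ^ i)))))

sum-scaledPowersOf3 : ∀ c n → sum (scaledPowersOf3 c n) ≡ c * repunit₃ n
sum-scaledPowersOf3 c zero    = sym (*-zeroʳ c)
sum-scaledPowersOf3 c (suc n) = trans (cong (c +_) (sum-scaledPowersOf3 (3 * c) n)) (c+3c*m≡c*[1+3m] c (repunit₃ n))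

∣subsetSum-scaledPowersOf3 : ∀ c n b → c ∣ subsetSum (scaledPowersOf3 c n) b
∣subsetSum-scaledPowersOf3 c zero    []          = c ∣0
∣subsetSum-scaledPowersOf3 c (suc n) (true ∷ b)  =
  ∣m∣n⇒∣m+n ∣-refl (∣-trans (n∣m*n 3) (∣subsetSum-scaledPowersOf3 (3 * c) n b))
∣subsetSum-scaledPowersOf3 c (suc n) (false ∷ b) = ∣-trans (n∣m*n 3) (∣subsetSum-scaledPowersOf3 (3 * c) n b)

-- Every subset sum of the tail is a multiple of 3c, so the head c cannot be traded for it.
scaledPowersOf3-head≢ : ∀ {c} n → 0 < c → ∀ a b →
  c + subsetSum (scaledPowersOf3 (3 * c) n) a ≢ subsetSum (scaledPowersOf3 (3 * c) n) b
scaledPowersOf3-head≢ {c} n 0<c a b eq =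
  <⇒≱ (c<3c 0<c) (∣⇒≤ {{>-nonZero 0<c}} (∣m+n∣m⇒∣n 3c∣Σa+c (∣subsetSum-scaledPowersOf3 (3 * c) n a)))
  where
  3c∣Σa+c : 3 * c ∣ subsetSum (scaledPowersOf3 (3 * c) n) a + c
  3c∣Σa+c = subst (3 * c ∣_) (trans (sym eq) (+-comm c _)) (∣subsetSum-scaledPowersOf3 (3 * c) n b)

scaledPowersOf3-dissociated : ∀ {c} n → 0 < c → Dissociated (scaledPowersOf3 c n)
scaledPowersOf3-dissociated zero _ [] [] _ = refl
scaledPowersOf3-dissociated {c} (suc n) 0<c (true ∷ a) (true ∷ b) eq =
  cong (true ∷_) (scaledPowersOf3-dissociated n (<-trans 0<c (c<3c 0<c)) a b (+-cancelˡ-≡ c _ _ eq))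
scaledPowersOf3-dissociated {c} (suc n) 0<c (false ∷ a) (false ∷ b) eq =
  cong (false ∷_) (scaledPowersOf3-dissociated n (<-trans 0<c (c<3c 0<c)) a b eq)
scaledPowersOf3-dissociated (suc n) 0<c (true ∷ a)  (false ∷ b) eq =
  contradiction eq (scaledPowersOf3-head≢ n 0<c a b)
scaledPowersOf3-dissociated (suc n) 0<c (false ∷ a) (true ∷ b)  eq =
  contradiction (sym eq) (scaledPowersOf3-head≢ n 0<c b a)

data Mod3View : ℕ → Set where
  0+3* : ∀ q → Mod3View (3 * q)
  1+3* : ∀ q → Mod3View (1 + 3 * q)
  2+3* : ∀ q → Mod3View (2 + 3 * q)

mod3View : ∀ x → Mod3View x
mod3View zero = 0+3* 0
mod3View (suc x) with mod3View x
... | 0+3* q = 1+3* q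
... | 1+3* q = 2+3* q
... | 2+3* q = subst Mod3View (*-suc 3 q) (0+3* (suc q))

3*q≤2+3*r⇒q≤r : ∀ q r → 3 * q ≤ 2 + 3 * r → q ≤ r
3*q≤2+3*r⇒q≤r q r 3q≤2+3r = ≤-pred (*-cancelˡ-< 3 q (suc r) (subst (3 * q <_) (sym (*-suc 3 r)) (s≤s 3q≤2+3r)))

-- Balanced ternary: write x = 3q + r with r ∈ {0, 1, −1} and expand q in the powers 3c, 9c, ….
scaledPowersOf3-spans : ∀ n c x → x ≤ repunit₃ n → InSpan (scaledPowersOf3 c n) (pos (c * x))
scaledPowersOf3-spans zero    c zero z≤n = [] , cong pos (sym (*-zeroʳ c))
scaledPowersOf3-spans (suc n) c x x≤ with mod3View x
... | 0+3* q with ε , Σε≡ ← scaledPowersOf3-spans n (3 * c) q (3*q≤2+3*r⇒q≤r q _ (m≤n⇒m≤1+n x≤)) =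
  zer ∷ ε , trans Σε≡ (cong pos (3c*m≡c*[3m] c q))
... | 1+3* q with ε , Σε≡ ← scaledPowersOf3-spans n (3 * c) q (*-cancelˡ-≤ 3 (≤-pred x≤)) =
  plus ∷ ε , trans (cong (pos c +ℤ_) Σε≡) (cong pos (c+3c*m≡c*[1+3m] c q))
... | 2+3* q
  with ε , Σε≡ ← scaledPowersOf3-spans n (3 * c) (suc q)
                   (3*q≤2+3*r⇒q≤r (suc q) _ (subst (_≤ 2 + 3 * repunit₃ n) (sym (*-suc 3 q)) (s≤s x≤))) =
  minus ∷ ε , trans (cong (- pos c +ℤ_) (trans Σε≡ (cong pos (regroup c q)))) (cancel (pos c) _)
  where
  regroup : ∀ c q → 3 * c * suc q ≡ c + c * (2 + 3 * q)
  regroup = ℕ-solve-∀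
  cancel : ∀ a b → - a +ℤ (a +ℤ b) ≡ b
  cancel = solve-∀

length-powersOf3 : ∀ k → length (powersOf3 k) ≡ suc k
length-powersOf3 k = trans (length-map (3 ^_) (upTo (suc k))) (length-upTo (suc k))

sum-powersOf3 : ∀ k → sum (powersOf3 k) ≡ repunit₃ (suc k)
sum-powersOf3 k = begin
  sum (powersOf3 k)                    ≡⟨ cong sum (powersOf3≡scaledPowersOf3 k) ⟩
  sum (scaledPowersOf3 1 (suc k))      ≡⟨ sum-scaledPowersOf3 1 (suc k) ⟩
  1 * repunit₃ (suc k)                 ≡⟨ *-identityˡ _ ⟩
  repunit₃ (suc k)                     ∎
  where open ≡-Reasoning

powersOf3-subset : ∀ {N k} → 3 ^ k ≤ N → SubsetOf N (powersOf3 k)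
powersOf3-subset {N} {k} 3^k≤N = Unique.map⁺ 3^-injective (Unique.upTo⁺ (suc k)) , All.tabulate inRange
  where
  inRange : ∀ {x} → x ∈ powersOf3 k → InRange N x
  inRange x∈S with i , i∈upTo , refl ← ∈-map⁻ (3 ^_) x∈S =
    m^n>0 3 i , ≤-trans (^-monoʳ-≤ 3 (≤-pred (∈-upTo⁻ i∈upTo))) 3^k≤N

powersOf3-dissociated : ∀ k → Dissociated (powersOf3 k)
powersOf3-dissociated k =
  subst Dissociated (sym (powersOf3≡scaledPowersOf3 k)) (scaledPowersOf3-dissociated (suc k) (s≤s z≤n))

fracCond⇒powersOf3-spans : ∀ {N k} → FracCond N k → Spans N (powersOf3 k)
fracCond⇒powersOf3-spans {N} {k} 2N<3^[1+k] x (_ , x≤N) =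
  subst₂ InSpan (sym (powersOf3≡scaledPowersOf3 k)) (cong pos (*-identityˡ x))
    (scaledPowersOf3-spans (suc k) 1 x (≤-trans x≤N N≤repunit₃))
  where
  N≤repunit₃ : N ≤ repunit₃ (suc k)
  N≤repunit₃ = *-cancelˡ-≤ 2 (≤-pred (subst (2 * N <_) (sym (1+2*repunit₃≡3^ (suc k))) 2N<3^[1+k]))

powersOf3-spans⇒fracCond : ∀ {N k} → 1 ≤ N → Spans N (powersOf3 k) → FracCond N k
powersOf3-spans⇒fracCond {N} {k} 1≤N spans =
  subst (2 * N <_) (1+2*repunit₃≡3^ (suc k)) (s≤s (*-monoʳ-≤ 2 N≤repunit₃))
  where
  N≤repunit₃ : N ≤ repunit₃ (suc k)
  N≤repunit₃ = subst (N ≤_) (sum-powersOf3 k) (inSpan⇒≤sum (spans N (1≤N , ≤-refl)))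

proposition3p3 : (N k : ℕ) → 1 ≤ N → IsFloorLog3 N k →
    (FracCond N k ⇔ (SubsetOf N (powersOf3 k) × MinSpanning N (powersOf3 k) × MaxDissociated N (powersOf3 k)))
    × (FracCond N k → IsDs N (suc k) × IsDdMinus N (suc k))
proposition3p3 N k 1≤N (3^k≤N , _) =
  mk⇔ (λ frac → S₁⊆[N] , (S₁⊆[N] , S₁-spans frac , subst (IsDs N) (sym |S₁|≡1+k) (isDs frac))
                         , S₁-maxDissociated frac)
      (λ (_ , (_ , spans , _) , _) → powersOf3-spans⇒fracCond 1≤N spans)
  , λ frac → isDs frac , isDdMinus frac
  where
  S₁⊆[N] : SubsetOf N (powersOf3 k)
  S₁⊆[N] = powersOf3-subset 3^k≤N
  |S₁|≡1+k : length (powersOf3 k) ≡ suc k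
  |S₁|≡1+k = length-powersOf3 k
  S₁-spans : FracCond N k → Spans N (powersOf3 k)
  S₁-spans = fracCond⇒powersOf3-spans
  S₁-maxDissociated : FracCond N k → MaxDissociated N (powersOf3 k)
  S₁-maxDissociated frac = spans∧dissociated⇒maxDissociated S₁⊆[N] (powersOf3-dissociated k) (S₁-spans frac)
  isDs : FracCond N k → IsDs N (suc k)
  isDs frac = (powersOf3 k , S₁⊆[N] , S₁-spans frac , |S₁|≡1+k) , λ S _ → spans⇒<length S 3^k≤N
  isDdMinus : FracCond N k → IsDdMinus N (suc k)
  isDdMinus frac =
    (powersOf3 k , S₁-maxDissociated frac , |S₁|≡1+k) , λ D → spans⇒<length D 3^k≤N ∘ maxDissociated⇒spans
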